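{- Let $m,n\in\mathbb{N}$. Let $B_m$ denote the Boolean lattice with $2^m$ elements and let $\mathfrak{c}_{(n+1)}$ denote a chain with $n+1$ elements. The number of Galois connections between $B_m$ and $\mathfrak{c}_{(n+1)}$ is $(n+1)^m$.
   Context: A Galois connection between posets $(P,\le_P)$ and $(Q,\le_Q)$ is a pair $(\varphi,\psi)$ of maps $\varphi:P\to Q$, $\psi:Q\to P$ such that for all $p,p_1,p_2\in P$ and $q,q_1,q_2\in Q$: $p_1\le_P p_2$ implies $\varphi p_1\ge_Q\varphi p_2$; $q_1\le_Q q_2$ implies $\psi q_1\ge_P\psi q_2$; $p\le_P\psi\varphi p$; and $q\le_Q\varphi\psi q$. The Boolean lattice with $2^m$ elements is the power set of an $m$-element set ordered by inclusion. -}

module Defs where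

open import Level using (Level; _⊔_)
open import Data.Nat using (ℕ; suc)
open import Data.Fin using (Fin)
import Data.Fin.Properties as FinP
import Data.Fin.Subset.Properties as SubP
open import Relation.Binary.Bundles using (Poset; Setoid)
open import Relation.Binary.PropositionalEquality using (_≡_)
import Relation.Binary.PropositionalEquality as ≡
open import Function.Bundles using (Inverse)

record GaloisConnection {c₁ ℓ₁ ℓ₂ c₂ ℓ₃ ℓ₄ : Level}
         (P : Poset c₁ ℓ₁ ℓ₂) (Q : Poset c₂ ℓ₃ ℓ₄)
         : Set (c₁ ⊔ ℓ₁ ⊔ ℓ₂ ⊔ c₂ ⊔ ℓ₃ ⊔ ℓ₄) where
  private
    module P = Poset P
    module Q = Poset Q
  field
    φ : P.Carrier → Q.Carrier
    ψ : Q.Carrier → P.Carrier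
    φ-antitone : ∀ {p₁ p₂} → p₁ P.≤ p₂ → φ p₂ Q.≤ φ p₁
    ψ-antitone : ∀ {q₁ q₂} → q₁ Q.≤ q₂ → ψ q₂ P.≤ ψ q₁
    ψφ-extensive : ∀ p → p P.≤ ψ (φ p)
    φψ-extensive : ∀ q → q Q.≤ φ (ψ q)

GC-setoid : {c₁ ℓ₁ ℓ₂ c₂ ℓ₃ ℓ₄ : Level}
            (P : Poset c₁ ℓ₁ ℓ₂) (Q : Poset c₂ ℓ₃ ℓ₄) →
            Setoid (c₁ ⊔ ℓ₁ ⊔ ℓ₂ ⊔ c₂ ⊔ ℓ₃ ⊔ ℓ₄) (c₁ ⊔ ℓ₁ ⊔ c₂ ⊔ ℓ₃)
GC-setoid P Q = record
  { Carrier = GaloisConnection P Q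
  ; _≈_ = λ g h → (∀ p → GaloisConnection.φ g p Q.≈ GaloisConnection.φ h p)
                × (∀ q → GaloisConnection.ψ g q P.≈ GaloisConnection.ψ h q)
  ; isEquivalence = record
    { refl  = (λ p → Q.Eq.refl) , (λ q → P.Eq.refl)
    ; sym   = λ (a , b) → (λ p → Q.Eq.sym (a p)) , (λ q → P.Eq.sym (b q))
    ; trans = λ (a , b) (c , d) → (λ p → Q.Eq.trans (a p) (c p))
                                , (λ q → P.Eq.trans (b q) (d q))
    }
  }
  where
  open import Data.Product using (_×_; _,_)
  module P = Poset P
  module Q = Poset Q

HasCardinality : {c ℓ : Level} → Setoid c ℓ → ℕ → Set (c ⊔ ℓ)
HasCardinality S k = Inverse (≡.setoid (Fin k)) S

BooleanLattice : ℕ → Poset _ _ _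
BooleanLattice m = SubP.⊆-poset m

Chain : ℕ → Poset _ _ _
Chain k = FinP.≤-poset k

-- An antitone Galois connection (φ, ψ) between posets is the same thing as the
-- adjunction q ≤ φ p ⇔ p ≤ ψ q. When P is the Boolean lattice of subsets of
-- Fin m, every p is the union of its singletons, so the adjunction forces
-- φ p = ⋀_{i ∈ p} φ ⁅ i ⁆ and ψ q = {i | q ≤ φ ⁅ i ⁆}. Conversely these formulas
-- define a Galois connection for any m values in a bounded meet-semilattice L.
-- Hence Galois connections correspond to L^m, and for the chain with n+1
-- elements there are (n+1)^m of them.
module Submission where

open import Defs
open import Data.Nat using (ℕ; zero; suc; _^_)
open import Data.Fin using (Fin; zero; suc; combine; finToFun; funToFin)
import Data.Fin.Properties as FinP
open import Data.Fin.Subset using (Subset; inside; outside; _∈_; _⊆_; ⁅_⁆)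
open import Data.Fin.Subset.Properties using (x∈⁅x⁆; x∈⁅y⁆⇒x≡y; ⊆-antisym)
open import Data.Vec using ([]; _∷_; here; there)
import Data.Vec.Functional.Relation.Binary.Equality.Setoid as Pointwise
open import Data.Product using (_,_)
open import Function.Base using (_∘_)
open import Function.Bundles using (Inverse; _⇔_; mk⇔; Equivalence)
import Function.Consequences.Setoid as Consequences
import Function.Construct.Composition as Composition
open import Function.Properties.Equivalence using () renaming (trans to ⇔-trans; sym to ⇔-sym)
open import Relation.Binary.Bundles using (Poset; Setoid)
open import Relation.Binary.Definitions using (Decidable)
open import Relation.Binary.Lattice.Bundles using (BoundedMeetSemilattice)
open import Relation.Binary.PropositionalEquality using (_≡_; refl; sym; cong₂; subst; setoid)
open import Relation.Nullary.Decidable using (yes; no; does)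
open import Relation.Nullary.Negation using (contradiction)

open Equivalence using (to; from)

module _ {a ℓ₁ ℓ₂} (P : Poset a ℓ₁ ℓ₂) where
  open Poset P using (_≈_; _≤_; antisym) renaming (refl to ≤-refl)

  ≈-by-lowerBounds : ∀ {x y} → (∀ {z} → z ≤ x ⇔ z ≤ y) → x ≈ y
  ≈-by-lowerBounds z≤x⇔z≤y = antisym (to z≤x⇔z≤y ≤-refl) (from z≤x⇔z≤y ≤-refl)

module _ {a ℓ₁ ℓ₂ b ℓ₃ ℓ₄} {P : Poset a ℓ₁ ℓ₂} {Q : Poset b ℓ₃ ℓ₄} where
  private
    module P = Poset P
    module Q = Poset Q

  galois⇒adjunction : (g : GaloisConnection P Q) → let open GaloisConnection g in
                      ∀ {p q} → q Q.≤ φ p ⇔ p P.≤ ψ q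
  galois⇒adjunction g = mk⇔ (λ q≤φp → P.trans (ψφ-extensive _) (ψ-antitone q≤φp))
                             (λ p≤ψq → Q.trans (φψ-extensive _) (φ-antitone p≤ψq))
    where open GaloisConnection g

  adjunction⇒galois : (φ : P.Carrier → Q.Carrier) (ψ : Q.Carrier → P.Carrier) →
                      (∀ {p q} → q Q.≤ φ p ⇔ p P.≤ ψ q) → GaloisConnection P Q
  adjunction⇒galois φ ψ adjunction = record
    { φ            = φ
    ; ψ            = ψ
    ; φ-antitone   = λ p₁≤p₂ → from adjunction (P.trans p₁≤p₂ (ψφ-extensive _))
    ; ψ-antitone   = λ q₁≤q₂ → to adjunction (Q.trans q₁≤q₂ (φψ-extensive _))
    ; ψφ-extensive = ψφ-extensive
    ; φψ-extensive = φψ-extensive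
    }
    where
    ψφ-extensive : ∀ p → p P.≤ ψ (φ p)
    ψφ-extensive p = to adjunction Q.refl

    φψ-extensive : ∀ q → q Q.≤ φ (ψ q)
    φψ-extensive q = from adjunction P.refl

∀∈⁅x⁆⇔ : ∀ {m p} {P : Fin m → Set p} {x} → (∀ {y} → y ∈ ⁅ x ⁆ → P y) ⇔ P x
∀∈⁅x⁆⇔ {P = P} {x} = mk⇔ (λ Pᵧ → Pᵧ (x∈⁅x⁆ x))
                         (λ Pₓ {y} y∈⁅x⁆ → subst P (sym (x∈⁅y⁆⇒x≡y x y∈⁅x⁆)) Pₓ)

x∈p⇒⁅x⁆⊆p : ∀ {m} {x : Fin m} {p : Subset m} → x ∈ p → ⁅ x ⁆ ⊆ p
x∈p⇒⁅x⁆⊆p = from ∀∈⁅x⁆⇔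

module _ {m b ℓ₃ ℓ₄} {Q : Poset b ℓ₃ ℓ₄} (g : GaloisConnection (BooleanLattice m) Q) where
  open Poset Q using (_≤_)
  open GaloisConnection g

  ∈ψ⇔≤φ⁅⁆ : ∀ {i q} → i ∈ ψ q ⇔ q ≤ φ ⁅ i ⁆
  ∈ψ⇔≤φ⁅⁆ {i} = mk⇔ (λ i∈ψq → from (galois⇒adjunction g) (x∈p⇒⁅x⁆⊆p i∈ψq))
                     (λ q≤φ⁅i⁆ → to (galois⇒adjunction g) q≤φ⁅i⁆ (x∈⁅x⁆ i))

  ≤φ⇔≤φ⁅⁆ : ∀ {p q} → q ≤ φ p ⇔ (∀ {i} → i ∈ p → q ≤ φ ⁅ i ⁆)
  ≤φ⇔≤φ⁅⁆ {p} {q} = mk⇔ ≤φ⇒≤φ⁅⁆ ≤φ⁅⁆⇒≤φ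
    where
    ≤φ⇒≤φ⁅⁆ : q ≤ φ p → ∀ {i} → i ∈ p → q ≤ φ ⁅ i ⁆
    ≤φ⇒≤φ⁅⁆ q≤φp i∈p = to ∈ψ⇔≤φ⁅⁆ (to (galois⇒adjunction g) q≤φp i∈p)

    ≤φ⁅⁆⇒≤φ : (∀ {i} → i ∈ p → q ≤ φ ⁅ i ⁆) → q ≤ φ p
    ≤φ⁅⁆⇒≤φ q≤φ⁅⁆ = from (galois⇒adjunction g) (λ i∈p → from ∈ψ⇔≤φ⁅⁆ (q≤φ⁅⁆ i∈p))

-- Decidability of ≤ is needed only to compute ψ q = above a q as a Subset.
module _ {c ℓ₁ ℓ₂} (L : BoundedMeetSemilattice c ℓ₁ ℓ₂)
         (_≤?_ : Decidable (BoundedMeetSemilattice._≤_ L)) where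
  open BoundedMeetSemilattice L hiding (refl; reflexive) renaming (Carrier to C)
  open import Relation.Binary.Lattice.Properties.MeetSemilattice meetSemilattice using (∧-cong)
  open Pointwise (Poset.Eq.setoid poset) using (_≋_; ≋-setoid; ≋-trans)

  ⋀ : ∀ {m} → (Fin m → C) → Subset m → C
  ⋀ a []            = ⊤
  ⋀ a (inside ∷ p)  = a zero ∧ ⋀ (a ∘ suc) p
  ⋀ a (outside ∷ p) = ⋀ (a ∘ suc) p

  ≤⋀⇒≤ : ∀ {m} (a : Fin m → C) (p : Subset m) {q} → q ≤ ⋀ a p → ∀ {i} → i ∈ p → q ≤ a i
  ≤⋀⇒≤ a (inside ∷ p)  q≤⋀ here       = trans q≤⋀ (x∧y≤x _ _)
  ≤⋀⇒≤ a (inside ∷ p)  q≤⋀ (there i∈p) = ≤⋀⇒≤ (a ∘ suc) p (trans q≤⋀ (x∧y≤y _ _)) i∈p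
  ≤⋀⇒≤ a (outside ∷ p) q≤⋀ (there i∈p) = ≤⋀⇒≤ (a ∘ suc) p q≤⋀ i∈p

  ⋀-greatest : ∀ {m} (a : Fin m → C) (p : Subset m) {q} → (∀ {i} → i ∈ p → q ≤ a i) → q ≤ ⋀ a p
  ⋀-greatest a []            q≤a = maximum _
  ⋀-greatest a (inside ∷ p)  q≤a = ∧-greatest (q≤a here) (⋀-greatest (a ∘ suc) p (q≤a ∘ there))
  ⋀-greatest a (outside ∷ p) q≤a = ⋀-greatest (a ∘ suc) p (q≤a ∘ there)

  ≤⋀⇔ : ∀ {m} (a : Fin m → C) (p : Subset m) {q} → q ≤ ⋀ a p ⇔ (∀ {i} → i ∈ p → q ≤ a i)
  ≤⋀⇔ a p = mk⇔ (≤⋀⇒≤ a p) (⋀-greatest a p)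

  above : ∀ {m} → (Fin m → C) → C → Subset m
  above {zero}  a q = []
  above {suc m} a q = does (q ≤? a zero) ∷ above (a ∘ suc) q

  ∈above⇒≤ : ∀ {m} (a : Fin m → C) {q} i → i ∈ above a q → q ≤ a i
  ∈above⇒≤ a {q} zero i∈ with q ≤? a zero
  ... | yes q≤a₀ = q≤a₀
  ∈above⇒≤ a (suc i) (there i∈) = ∈above⇒≤ (a ∘ suc) i i∈

  ≤⇒∈above : ∀ {m} (a : Fin m → C) {q} i → q ≤ a i → i ∈ above a q
  ≤⇒∈above a {q} zero q≤a₀ with q ≤? a zero
  ... | yes _    = here
  ... | no  q≰a₀ = contradiction q≤a₀ q≰a₀
  ≤⇒∈above a (suc i) q≤a = there (≤⇒∈above (a ∘ suc) i q≤a)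

  ∈above⇔ : ∀ {m} (a : Fin m → C) {q i} → i ∈ above a q ⇔ q ≤ a i
  ∈above⇔ a {i = i} = mk⇔ (∈above⇒≤ a i) (≤⇒∈above a i)

  fromValues : ∀ {m} → (Fin m → C) → GaloisConnection (BooleanLattice m) poset
  fromValues a = adjunction⇒galois (⋀ a) (above a) λ {p} → ⇔-trans (≤⋀⇔ a p)
    (mk⇔ (λ q≤a {i} i∈p → from (∈above⇔ a) (q≤a i∈p)) (λ p⊆ {i} i∈p → to (∈above⇔ a) (p⊆ i∈p)))

  valuesAtSingletons : ∀ {m} → GaloisConnection (BooleanLattice m) poset → Fin m → C
  valuesAtSingletons g i = GaloisConnection.φ g ⁅ i ⁆

  ⋀-cong : ∀ {m} {a b : Fin m → C} → a ≋ b → ∀ p → ⋀ a p ≈ ⋀ b p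
  ⋀-cong a≋b []            = Eq.refl
  ⋀-cong a≋b (inside ∷ p)  = ∧-cong (a≋b zero) (⋀-cong (a≋b ∘ suc) p)
  ⋀-cong a≋b (outside ∷ p) = ⋀-cong (a≋b ∘ suc) p

  above-cong : ∀ {m} {a b : Fin m → C} → a ≋ b → ∀ q → above a q ≡ above b q
  above-cong {a = a} {b} a≋b q =
    ⊆-antisym (from (∈above⇔ b) ∘ ≤-respʳ-≈ (a≋b _) ∘ to (∈above⇔ a))
              (from (∈above⇔ a) ∘ ≤-respʳ-≈ (Eq.sym (a≋b _)) ∘ to (∈above⇔ b))

  ⋀⁅⁆≈ : ∀ {m} (a : Fin m → C) i → ⋀ a ⁅ i ⁆ ≈ a i
  ⋀⁅⁆≈ a i = ≈-by-lowerBounds poset (⇔-trans (≤⋀⇔ a ⁅ i ⁆) ∀∈⁅x⁆⇔)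

  module _ {m} (g : GaloisConnection (BooleanLattice m) poset) where
    open GaloisConnection g

    ⋀-valuesAtSingletons≈φ : ∀ p → ⋀ (valuesAtSingletons g) p ≈ φ p
    ⋀-valuesAtSingletons≈φ p =
      ≈-by-lowerBounds poset (⇔-trans (≤⋀⇔ (valuesAtSingletons g) p) (⇔-sym (≤φ⇔≤φ⁅⁆ g)))

    above-valuesAtSingletons≡ψ : ∀ q → above (valuesAtSingletons g) q ≡ ψ q
    above-valuesAtSingletons≡ψ q =
      ⊆-antisym (from (∈ψ⇔≤φ⁅⁆ g) ∘ to (∈above⇔ (valuesAtSingletons g)))
                (from (∈above⇔ (valuesAtSingletons g)) ∘ to (∈ψ⇔≤φ⁅⁆ g))

  galois↔values : ∀ m → Inverse (≋-setoid m) (GC-setoid (BooleanLattice m) poset)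
  galois↔values m = record
    { to        = fromValues
    ; from      = valuesAtSingletons
    ; to-cong   = fromValues-cong
    ; from-cong = λ {g} {h} → valuesAtSingletons-cong {g} {h}
    ; inverse   = (λ {g} {a} → fromValues-inverse {g} {a}) , (λ {a} {g} → valuesAtSingletons-inverse {a} {g})
    }
    where
    module G = Setoid (GC-setoid (BooleanLattice m) poset)

    fromValues-cong : ∀ {a b} → a ≋ b → fromValues {m} a G.≈ fromValues b
    fromValues-cong a≋b = ⋀-cong a≋b , above-cong a≋b

    valuesAtSingletons-cong : ∀ {g h} → g G.≈ h → valuesAtSingletons {m} g ≋ valuesAtSingletons h
    valuesAtSingletons-cong (φ≈ , _) i = φ≈ ⁅ i ⁆

    fromValues-inverse : ∀ {g a} → a ≋ valuesAtSingletons g → fromValues a G.≈ g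
    fromValues-inverse {g} {a} a≋vg = G.trans {fromValues a} {fromValues (valuesAtSingletons g)} {g}
      (fromValues-cong a≋vg) (⋀-valuesAtSingletons≈φ g , above-valuesAtSingletons≡ψ g)

    valuesAtSingletons-inverse : ∀ {a g} → g G.≈ fromValues a → valuesAtSingletons g ≋ a
    valuesAtSingletons-inverse {a} {g} g≈fa = ≋-trans (valuesAtSingletons-cong {g} {fromValues a} g≈fa) (⋀⁅⁆≈ a)

-- Built from FinP.≤-isPartialOrder so that its poset is definitionally Chain (suc n).
chain : ℕ → BoundedMeetSemilattice _ _ _
chain n = record
  { isBoundedMeetSemilattice = record
    { isMeetSemilattice = record
      { isPartialOrder = FinP.≤-isPartialOrder
      ; infimum        = λ x y → x⊓y≤x x y , x⊓y≤y x y , λ z → ⊓-glb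
      }
    ; maximum = FinP.≤fromℕ
    }
  }
  where open import Algebra.Construct.NaturalChoice.Min (FinP.≤-totalOrder (suc n))

funToFin-cong : ∀ {m k} {f g : Fin m → Fin k} → (∀ i → f i ≡ g i) → funToFin f ≡ funToFin g
funToFin-cong {zero}  f≗g = refl
funToFin-cong {suc m} f≗g = cong₂ combine (f≗g zero) (funToFin-cong (f≗g ∘ suc))

^↔→-pointwise : ∀ k m → Inverse (setoid (Fin (k ^ m))) (Pointwise.≋-setoid (setoid (Fin k)) m)
^↔→-pointwise k m = record
  { to        = finToFun
  ; from      = funToFin
  ; to-cong   = λ { refl i → refl }
  ; from-cong = funToFin-cong
  ; inverse   = strictlyInverseˡ⇒inverseˡ {f⁻¹ = funToFin} (λ { refl i → refl }) FinP.finToFun-funToFin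
              , strictlyInverseʳ⇒inverseʳ {f = finToFun} funToFin-cong (FinP.funToFin-finToFin {m} {k})
  }
  where open Consequences (setoid (Fin (k ^ m))) (Pointwise.≋-setoid (setoid (Fin k)) m)

proposition5p8 : (m n : ℕ) →
    HasCardinality (GC-setoid (BooleanLattice m) (Chain (suc n))) (suc n ^ m)
proposition5p8 m n = Composition.inverse (^↔→-pointwise (suc n) m) (galois↔values (chain n) FinP._≤?_ m)
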